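{- For all $n\ge1$, $\sum_{k=1}^n|U(n,k)|=F_n$, where $F_0=F_1=1$ and $F_n=F_{n-1}+F_{n-2}$ for $n\ge2$.
   Context: $\mathcal R(n,k)$ is the set of RG-words $w=w_1\cdots w_n$ (positive integers, $w_1=1$, $w_i\le\max(w_1,\dots,w_{i-1})+1$ for $i\ge2$, $\max_iw_i=k$). $U(n,k)$ is the set of words in $\mathcal R(n,k)$ that are weakly increasing and in which each even letter occurs exactly once. -}

module Defs where

open import Data.Nat using (ℕ; zero; suc; _+_; _≤_; _≤?_; _≟_; _<_)
open import Data.Nat.Properties using (≤-refl)
open import Data.List using (List; []; _∷_; length; filter; map; concatMap; upTo; foldr; sum)
open import Data.List.Relation.Unary.All using (All; all?)
open import Data.Product using (_×_; _,_; Σ)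
open import Data.Unit using (⊤)
open import Relation.Nullary using (Dec; yes; no; ¬_)
open import Relation.Nullary.Decidable using (_×-dec_; ¬?)
open import Relation.Binary.PropositionalEquality using (_≡_)
open import Data.Nat.Divisibility using (_∣_; _∣?_)

F : ℕ → ℕ
F zero = 1
F (suc zero) = 1
F (suc (suc n)) = F (suc n) + F n

Word : Set
Word = List ℕ

maxW : Word → ℕ
maxW [] = 0
maxW (x ∷ xs) = x Data.Nat.⊔ maxW xs

-- RG condition on the tail, given the current prefix maximum m:
-- every letter is positive and at most (max of the preceding letters) + 1.
RGFrom : ℕ → Word → Set
RGFrom m [] = ⊤
RGFrom m (x ∷ xs) = (1 ≤ x × x ≤ suc m) × RGFrom (m Data.Nat.⊔ x) xs

IsRG : Word → Set
IsRG [] = ⊤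
IsRG (x ∷ xs) = x ≡ 1 × RGFrom x xs

InR : ℕ → ℕ → Word → Set
InR n k w = (length w ≡ n × IsRG w) × maxW w ≡ k

WeaklyInc : Word → Set
WeaklyInc [] = ⊤
WeaklyInc (x ∷ []) = ⊤
WeaklyInc (x ∷ y ∷ ys) = x ≤ y × WeaklyInc (y ∷ ys)

occ : ℕ → Word → ℕ
occ a [] = 0
occ a (x ∷ xs) with x ≟ a
... | yes _ = suc (occ a xs)
... | no _ = occ a xs

EvenOnce : Word → Set
EvenOnce w = All (λ a → 2 ∣ a → occ a w ≡ 1) w

InU : ℕ → ℕ → Word → Set
InU n k w = (InR n k w × WeaklyInc w) × EvenOnce w

rgFrom? : ∀ m w → Dec (RGFrom m w)
rgFrom? m [] = yes _
rgFrom? m (x ∷ xs) = ((1 ≤? x) ×-dec (x ≤? suc m)) ×-dec rgFrom? (m Data.Nat.⊔ x) xs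

isRG? : ∀ w → Dec (IsRG w)
isRG? [] = yes _
isRG? (x ∷ xs) = (x ≟ 1) ×-dec rgFrom? x xs

weaklyInc? : ∀ w → Dec (WeaklyInc w)
weaklyInc? [] = yes _
weaklyInc? (x ∷ []) = yes _
weaklyInc? (x ∷ y ∷ ys) = (x ≤? y) ×-dec weaklyInc? (y ∷ ys)

private
  impl? : ∀ {A B : Set} → Dec A → Dec B → Dec (A → B)
  impl? _ (yes b) = yes (λ _ → b)
  impl? (no ¬a) _ = yes (λ a → Data.Empty.⊥-elim (¬a a))
    where import Data.Empty
  impl? (yes a) (no ¬b) = no (λ f → ¬b (f a))

evenOnce? : ∀ w → Dec (EvenOnce w)
evenOnce? w = all? (λ a → impl? (2 ∣? a) (occ a w ≟ 1)) w

inU? : ∀ n k w → Dec (InU n k w)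
inU? n k w = ((((length w ≟ n) ×-dec isRG? w) ×-dec (maxW w ≟ k)) ×-dec weaklyInc? w) ×-dec evenOnce? w

wordsOver : ℕ → ℕ → List Word
wordsOver b zero = [] ∷ []
wordsOver b (suc len) = concatMap (λ i → map (suc i ∷_) (wordsOver b len)) (upTo b)

-- |U(n,k)|: every RG-word of length n has all letters in {1,…,n},
-- so U(n,k) is exactly the set of words in wordsOver n n satisfying InU n k
-- (wordsOver n n has no duplicates).
cardU : ℕ → ℕ → ℕ
cardU n k = length (filter (inU? n k) (wordsOver n n))

sumFrom1 : ℕ → (ℕ → ℕ) → ℕ
sumFrom1 zero f = 0
sumFrom1 (suc n) f = sumFrom1 n f + f (suc n)

module Submission where

-- A word lies in U(n,k) only for k = max w, so Σ_{k=1}^n |U(n,k)| counts the words of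
-- length n that are weakly increasing RG-words in which each even letter occurs once.
-- These are exactly the words accepted by a small automaton: reading from the virtual
-- letter 0, each letter must either be the previous letter plus one, or repeat the
-- previous letter when that letter is odd (relation 'Step', predicate 'Accepts').
-- Counting the accepted words of length len over the alphabet {1,…,b} from state ℓ,
-- the first letter can only be ℓ (if ℓ is odd) or ℓ+1, which gives the Fibonacci
-- recurrence; hence the count is F len for even ℓ and F (len+1) for odd ℓ.

open import Defs
open import Data.Nat using (ℕ; zero; suc; _+_; _*_; _≤_; _<_; z≤n; s≤s; _≟_)
open import Data.Nat.Properties
open import Data.Nat.Divisibility using (_∣_; _∣?_; _∣0; ∣-refl; ∣1⇒≡1; ∣m∣n⇒∣m+n; ∣m+n∣m⇒∣n)
open import Data.List using (List; []; _∷_; length; filter; map; concatMap; upTo; _++_)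
open import Data.List.Properties using (upTo-∷ʳ)
open import Data.List.Relation.Unary.All as All using (All; []; _∷_)
open import Data.List.Relation.Unary.Linked using (Linked; []; [-]; _∷_; linked?)
open import Data.Product using (_×_; _,_; proj₁; proj₂)
open import Data.Sum using (_⊎_; inj₁; inj₂)
open import Data.Unit using (tt)
open import Relation.Nullary using (Dec; yes; no; ¬_; contradiction)
open import Relation.Nullary.Decidable using (_×-dec_)
open import Relation.Binary.PropositionalEquality
open import Function using (_∘_)
open import Algebra.Properties.CommutativeSemigroup +-commutativeSemigroup
  using () renaming (interchange to +-interchange)

𝟙 : ∀ {A : Set} → Dec A → ℕ
𝟙 (yes _) = 1
𝟙 (no _)  = 0

𝟙-yes : ∀ {A : Set} (d : Dec A) → A → 𝟙 d ≡ 1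
𝟙-yes (yes _) _ = refl
𝟙-yes (no ¬a) a = contradiction a ¬a

𝟙-no : ∀ {A : Set} (d : Dec A) → ¬ A → 𝟙 d ≡ 0
𝟙-no (yes a) ¬a = contradiction a ¬a
𝟙-no (no _)  _  = refl

𝟙-⇔ : ∀ {A B : Set} (a : Dec A) (b : Dec B) → (A → B) → (B → A) → 𝟙 a ≡ 𝟙 b
𝟙-⇔ (yes a) b f g = sym (𝟙-yes b (f a))
𝟙-⇔ (no ¬a) b f g = sym (𝟙-no b (¬a ∘ g))

𝟙-× : ∀ {A B : Set} (a : Dec A) (b : Dec B) → 𝟙 (a ×-dec b) ≡ 𝟙 a * 𝟙 b
𝟙-× (yes _) (yes _) = refl
𝟙-× (yes _) (no _)  = refl
𝟙-× (no _)  _       = refl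

sumOver : ∀ {A : Set} → (A → ℕ) → List A → ℕ
sumOver f []       = 0
sumOver f (x ∷ xs) = f x + sumOver f xs

length-filter≡sumOver : ∀ {A : Set} {P : A → Set} (P? : ∀ x → Dec (P x)) (xs : List A) →
  length (filter P? xs) ≡ sumOver (λ x → 𝟙 (P? x)) xs
length-filter≡sumOver P? []       = refl
length-filter≡sumOver P? (x ∷ xs) with P? x
... | yes _ = cong suc (length-filter≡sumOver P? xs)
... | no _  = length-filter≡sumOver P? xs

sumOver-cong : ∀ {A : Set} {f g : A → ℕ} → (∀ x → f x ≡ g x) → ∀ xs → sumOver f xs ≡ sumOver g xs
sumOver-cong f≗g []       = refl
sumOver-cong f≗g (x ∷ xs) = cong₂ _+_ (f≗g x) (sumOver-cong f≗g xs)

sumOver-zero : ∀ {A : Set} (xs : List A) → sumOver (λ _ → 0) xs ≡ 0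
sumOver-zero []       = refl
sumOver-zero (x ∷ xs) = sumOver-zero xs

sumOver-+ : ∀ {A : Set} (f g : A → ℕ) xs → sumOver (λ x → f x + g x) xs ≡ sumOver f xs + sumOver g xs
sumOver-+ f g []       = refl
sumOver-+ f g (x ∷ xs) = begin
  f x + g x + sumOver (λ x → f x + g x) xs    ≡⟨ cong (f x + g x +_) (sumOver-+ f g xs) ⟩
  f x + g x + (sumOver f xs + sumOver g xs)   ≡⟨ +-interchange (f x) (g x) _ _ ⟩
  f x + sumOver f xs + (g x + sumOver g xs)   ∎
  where open ≡-Reasoning

sumOver-* : ∀ {A : Set} c (f : A → ℕ) xs → sumOver (λ x → c * f x) xs ≡ c * sumOver f xs
sumOver-* c f []       = sym (*-zeroʳ c)
sumOver-* c f (x ∷ xs) = trans (cong (c * f x +_) (sumOver-* c f xs)) (sym (*-distribˡ-+ c (f x) _))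

sumOver-++ : ∀ {A : Set} (f : A → ℕ) xs ys → sumOver f (xs ++ ys) ≡ sumOver f xs + sumOver f ys
sumOver-++ f []       ys = refl
sumOver-++ f (x ∷ xs) ys = trans (cong (f x +_) (sumOver-++ f xs ys)) (sym (+-assoc (f x) _ _))

sumOver-map : ∀ {A B : Set} (f : B → ℕ) (g : A → B) xs → sumOver f (map g xs) ≡ sumOver (f ∘ g) xs
sumOver-map f g []       = refl
sumOver-map f g (x ∷ xs) = cong (f (g x) +_) (sumOver-map f g xs)

sumOver-concatMap : ∀ {A B : Set} (f : B → ℕ) (g : A → List B) xs →
  sumOver f (concatMap g xs) ≡ sumOver (sumOver f ∘ g) xs
sumOver-concatMap f g []       = refl
sumOver-concatMap f g (x ∷ xs) =
  trans (sumOver-++ f (g x) (concatMap g xs)) (cong (sumOver f (g x) +_) (sumOver-concatMap f g xs))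

sumOver-upTo : ∀ (f : ℕ → ℕ) b → sumOver (f ∘ suc) (upTo b) ≡ sumFrom1 b f
sumOver-upTo f zero    = refl
sumOver-upTo f (suc b) = begin
  sumOver (f ∘ suc) (upTo (suc b))              ≡⟨ cong (sumOver (f ∘ suc)) (upTo-∷ʳ b) ⟨
  sumOver (f ∘ suc) (upTo b ++ b ∷ [])          ≡⟨ sumOver-++ (f ∘ suc) (upTo b) _ ⟩
  sumOver (f ∘ suc) (upTo b) + (f (suc b) + 0)  ≡⟨ cong₂ _+_ (sumOver-upTo f b) (+-identityʳ _) ⟩
  sumFrom1 b f + f (suc b)                      ∎
  where open ≡-Reasoning

sumFrom1-cong : ∀ n {f g : ℕ → ℕ} → (∀ k → f k ≡ g k) → sumFrom1 n f ≡ sumFrom1 n g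
sumFrom1-cong zero    f≗g = refl
sumFrom1-cong (suc n) f≗g = cong₂ _+_ (sumFrom1-cong n f≗g) (f≗g (suc n))

sumFrom1-sumOver : ∀ {A : Set} n (g : ℕ → A → ℕ) xs →
  sumFrom1 n (λ k → sumOver (g k) xs) ≡ sumOver (λ x → sumFrom1 n (λ k → g k x)) xs
sumFrom1-sumOver zero    g xs = sym (sumOver-zero xs)
sumFrom1-sumOver (suc n) g xs =
  trans (cong (_+ sumOver (g (suc n)) xs) (sumFrom1-sumOver n g xs))
        (sym (sumOver-+ (λ x → sumFrom1 n (λ k → g k x)) (g (suc n)) xs))

sumFrom1-zero : ∀ n (f : ℕ → ℕ) → (∀ k → 1 ≤ k → k ≤ n → f k ≡ 0) → sumFrom1 n f ≡ 0
sumFrom1-zero zero    f f≡0 = refl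
sumFrom1-zero (suc n) f f≡0 =
  cong₂ _+_ (sumFrom1-zero n f (λ k 1≤k k≤n → f≡0 k 1≤k (m≤n⇒m≤1+n k≤n))) (f≡0 (suc n) (s≤s z≤n) ≤-refl)

-- A sum whose terms vanish before the last one (the 0-th term counts for n = 0).
sumFrom1-last : ∀ n (f : ℕ → ℕ) → f 0 ≡ 0 → (∀ k → 1 ≤ k → k < n → f k ≡ 0) → sumFrom1 n f ≡ f n
sumFrom1-last zero    f f0≡0 _   = sym f0≡0
sumFrom1-last (suc n) f _    f≡0 =
  cong (_+ f (suc n)) (sumFrom1-zero n f (λ k 1≤k k≤n → f≡0 k 1≤k (s≤s k≤n)))

sumFrom1-pair : ∀ n m (f : ℕ → ℕ) → suc m ≤ n → f 0 ≡ 0 →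
  (∀ k → k ≢ m → k ≢ suc m → f k ≡ 0) → sumFrom1 n f ≡ f m + f (suc m)
sumFrom1-pair (suc n) m f (s≤s m≤n) f0≡0 f≡0 with m≤n⇒m<n∨m≡n m≤n
... | inj₂ refl = cong (_+ f (suc m)) (sumFrom1-last m f f0≡0 below-m)
  where
  below-m : ∀ k → 1 ≤ k → k < m → f k ≡ 0
  below-m k _ k<m = f≡0 k (<⇒≢ k<m) (<⇒≢ (m<n⇒m<1+n k<m))
... | inj₁ m<n  = begin
  sumFrom1 n f + f (suc n)   ≡⟨ cong₂ _+_ (sumFrom1-pair n m f m<n f0≡0 f≡0) last-vanishes ⟩
  f m + f (suc m) + 0        ≡⟨ +-identityʳ _ ⟩
  f m + f (suc m)            ∎
  where
  open ≡-Reasoning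
  last-vanishes : f (suc n) ≡ 0
  last-vanishes = f≡0 (suc n) (>⇒≢ (m<n⇒m<1+n m<n)) (>⇒≢ (s≤s m<n))

sumFrom1-single : ∀ n m (f : ℕ → ℕ) → 1 ≤ m → m ≤ n → (∀ k → k ≢ m → f k ≡ 0) → sumFrom1 n f ≡ f m
sumFrom1-single n (suc m) f _ m<n f≡0 =
  trans (sumFrom1-pair n m f m<n (f≡0 0 (λ ())) (λ k _ k≢1+m → f≡0 k k≢1+m))
        (cong (_+ f (suc m)) (f≡0 m (<⇒≢ ≤-refl)))

sumOver-wordsOver-suc : ∀ (f : Word → ℕ) b len →
  sumOver f (wordsOver b (suc len)) ≡ sumFrom1 b (λ x → sumOver (λ v → f (x ∷ v)) (wordsOver b len))
sumOver-wordsOver-suc f b len = begin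
  sumOver f (concatMap (λ i → map (suc i ∷_) (wordsOver b len)) (upTo b))
    ≡⟨ sumOver-concatMap f _ (upTo b) ⟩
  sumOver (λ i → sumOver f (map (suc i ∷_) (wordsOver b len))) (upTo b)
    ≡⟨ sumOver-cong (λ i → sumOver-map f (suc i ∷_) (wordsOver b len)) (upTo b) ⟩
  sumOver (λ i → sumOver (λ v → f (suc i ∷ v)) (wordsOver b len)) (upTo b)
    ≡⟨ sumOver-upTo (λ x → sumOver (λ v → f (x ∷ v)) (wordsOver b len)) b ⟩
  sumFrom1 b (λ x → sumOver (λ v → f (x ∷ v)) (wordsOver b len))
    ∎
  where open ≡-Reasoning

sumOver-wordsOver-cong : ∀ b len {f g : Word → ℕ} → (∀ w → length w ≡ len → f w ≡ g w) →
  sumOver f (wordsOver b len) ≡ sumOver g (wordsOver b len)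
sumOver-wordsOver-cong b zero      f≗g = cong (_+ 0) (f≗g [] refl)
sumOver-wordsOver-cong b (suc len) {f} {g} f≗g = begin
  sumOver f (wordsOver b (suc len))
    ≡⟨ sumOver-wordsOver-suc f b len ⟩
  sumFrom1 b (λ x → sumOver (λ v → f (x ∷ v)) (wordsOver b len))
    ≡⟨ sumFrom1-cong b (λ x → sumOver-wordsOver-cong b len (λ v ∣v∣≡len → f≗g (x ∷ v) (cong suc ∣v∣≡len))) ⟩
  sumFrom1 b (λ x → sumOver (λ v → g (x ∷ v)) (wordsOver b len))
    ≡⟨ sumOver-wordsOver-suc g b len ⟨
  sumOver g (wordsOver b (suc len))
    ∎
  where open ≡-Reasoning

even-or-next-even : ∀ n → 2 ∣ n ⊎ 2 ∣ suc n
even-or-next-even zero    = inj₁ (2 ∣0)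
even-or-next-even (suc n) with even-or-next-even n
... | inj₁ 2∣n   = inj₂ (∣m∣n⇒∣m+n (∣-refl {2}) 2∣n)
... | inj₂ 2∣1+n = inj₁ 2∣1+n

even⇒next-odd : ∀ {n} → 2 ∣ n → ¬ 2 ∣ suc n
even⇒next-odd {n} 2∣n 2∣1+n =
  contradiction (∣1⇒≡1 (∣m+n∣m⇒∣n (subst (2 ∣_) (+-comm 1 n) 2∣1+n) 2∣n)) (λ ())

odd⇒next-even : ∀ {n} → ¬ 2 ∣ n → 2 ∣ suc n
odd⇒next-even {n} ¬2∣n with even-or-next-even n
... | inj₁ 2∣n   = contradiction 2∣n ¬2∣n
... | inj₂ 2∣1+n = 2∣1+n

data Step : ℕ → ℕ → Set where
  repeat : ∀ {ℓ} → ¬ 2 ∣ ℓ → Step ℓ ℓ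
  next   : ∀ {ℓ} → Step ℓ (suc ℓ)

step? : ∀ ℓ x → Dec (Step ℓ x)
step? ℓ x with x ≟ suc ℓ | x ≟ ℓ
... | yes refl | _        = yes next
... | no x≢1+ℓ | no x≢ℓ   = no λ { (repeat _) → x≢ℓ refl ; next → x≢1+ℓ refl }
... | no _     | yes refl with 2 ∣? ℓ
...   | yes 2∣ℓ = no λ { (repeat ¬2∣ℓ) → ¬2∣ℓ 2∣ℓ }
...   | no ¬2∣ℓ = yes (repeat ¬2∣ℓ)

step-bounds : ∀ {ℓ x} → Step ℓ x → ℓ ≤ x × x ≤ suc ℓ
step-bounds (repeat _) = ≤-refl , n≤1+n _
step-bounds next       = n≤1+n _ , ≤-refl

-- Every letter produced by a step is positive (0 is even, so it is never repeated).
step-positive : ∀ {ℓ x} → Step ℓ x → 1 ≤ x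
step-positive (repeat {zero} ¬2∣0) = contradiction (2 ∣0) ¬2∣0
step-positive (repeat {suc _} _)   = s≤s z≤n
step-positive next                 = s≤s z≤n

even-step : ∀ {ℓ x} → 2 ∣ ℓ → Step ℓ x → x ≡ suc ℓ
even-step 2∣ℓ (repeat ¬2∣ℓ) = contradiction 2∣ℓ ¬2∣ℓ
even-step _   next          = refl

Accepts : ℕ → Word → Set
Accepts ℓ xs = Linked Step (ℓ ∷ xs)

accepts? : ∀ ℓ xs → Dec (Accepts ℓ xs)
accepts? ℓ xs = linked? step? (ℓ ∷ xs)

𝟙-accepts-∷ : ∀ ℓ x v → 𝟙 (accepts? ℓ (x ∷ v)) ≡ 𝟙 (step? ℓ x) * 𝟙 (accepts? x v)
𝟙-accepts-∷ ℓ x v =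
  trans (𝟙-⇔ (accepts? ℓ (x ∷ v)) (step? ℓ x ×-dec accepts? x v)
              (λ { (s ∷ a) → s , a }) (λ { (s , a) → s ∷ a }))
        (𝟙-× (step? ℓ x) (accepts? x v))

occ-hit : ∀ a ys → occ a (a ∷ ys) ≡ suc (occ a ys)
occ-hit a ys with a ≟ a
... | yes _   = refl
... | no a≢a = contradiction refl a≢a

occ-skip : ∀ {a x} ys → x ≢ a → occ a (x ∷ ys) ≡ occ a ys
occ-skip {a} {x} ys x≢a with x ≟ a
... | yes x≡a = contradiction x≡a x≢a
... | no _    = refl

occ-mono : ∀ a x ys → occ a ys ≤ occ a (x ∷ ys)
occ-mono a x ys with x ≟ a
... | yes _ = n≤1+n _
... | no _  = ≤-refl

occ-absent : ∀ {a} ys → All (_≢ a) ys → occ a ys ≡ 0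
occ-absent []       []              = refl
occ-absent (y ∷ ys) (y≢a ∷ ys≢a) = trans (occ-skip ys y≢a) (occ-absent ys ys≢a)

accepts-above : ∀ {ℓ xs} → Accepts ℓ xs → All (ℓ ≤_) xs
accepts-above [-]     = []
accepts-above {ℓ} (_∷_ {y = x} s a) = ℓ≤x ∷ All.map (≤-trans ℓ≤x) (accepts-above a)
  where
  ℓ≤x : ℓ ≤ x
  ℓ≤x = proj₁ (step-bounds s)

accepts-even-above : ∀ {ℓ xs} → 2 ∣ ℓ → Accepts ℓ xs → All (ℓ <_) xs
accepts-even-above 2∣ℓ [-] = []
accepts-even-above 2∣ℓ (s ∷ a) with even-step 2∣ℓ s
... | refl = ≤-refl ∷ accepts-above a

accepts⇒RGFrom : ∀ {ℓ xs} → Accepts ℓ xs → RGFrom ℓ xs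
accepts⇒RGFrom [-] = tt
accepts⇒RGFrom (_∷_ {xs = ys} s a) =
  (step-positive s , proj₂ (step-bounds s)) ,
  subst (λ m → RGFrom m ys) (sym (m≤n⇒m⊔n≡n (proj₁ (step-bounds s)))) (accepts⇒RGFrom a)

accepts⇒WeaklyInc : ∀ {ℓ xs} → Accepts ℓ xs → WeaklyInc (ℓ ∷ xs)
accepts⇒WeaklyInc [-]     = tt
accepts⇒WeaklyInc (s ∷ a) = proj₁ (step-bounds s) , accepts⇒WeaklyInc a

-- An even letter x is followed only by larger letters, and an even letter other than x
-- is unaffected by x; so every even letter of an accepted word occurs once.
accepts⇒EvenOnce : ∀ {ℓ xs} → Accepts ℓ xs → EvenOnce xs
accepts⇒EvenOnce [-] = []
accepts⇒EvenOnce (_∷_ {y = x} {xs = ys} _ a) = first ∷ rest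
  where
  first : 2 ∣ x → occ x (x ∷ ys) ≡ 1
  first 2∣x = trans (occ-hit x ys)
    (cong suc (occ-absent ys (All.map (λ x<y → ≢-sym (<⇒≢ x<y)) (accepts-even-above 2∣x a))))
  rest : All (λ b → 2 ∣ b → occ b (x ∷ ys) ≡ 1) ys
  rest with 2 ∣? x
  ... | yes 2∣x = All.zipWith (λ (once , x<b) 2∣b → trans (occ-skip ys (<⇒≢ x<b)) (once 2∣b))
                              (accepts⇒EvenOnce a , accepts-even-above 2∣x a)
  ... | no ¬2∣x = All.map (λ once 2∣b → trans (occ-skip ys (odd≢even ¬2∣x 2∣b)) (once 2∣b))
                          (accepts⇒EvenOnce a)
    where
    odd≢even : ∀ {b} → ¬ 2 ∣ x → 2 ∣ b → x ≢ b
    odd≢even ¬2∣x 2∣b refl = ¬2∣x 2∣b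

accepts⇒maxW : ∀ {ℓ xs} → Accepts ℓ xs → maxW xs ≤ ℓ + length xs
accepts⇒maxW [-] = z≤n
accepts⇒maxW {ℓ} (_∷_ {y = x} {xs = ys} s a) =
  ≤-trans (⊔-lub (≤-trans x≤1+ℓ (m≤m+n (suc ℓ) (length ys)))
                 (≤-trans (accepts⇒maxW a) (+-monoˡ-≤ (length ys) x≤1+ℓ)))
          (≤-reflexive (sym (+-suc ℓ (length ys))))
  where
  x≤1+ℓ : x ≤ suc ℓ
  x≤1+ℓ = proj₂ (step-bounds s)

accepted⇒InU : ∀ {w} → Accepts 0 w → InU (length w) (maxW w) w
accepted⇒InU [-] = (((refl , tt) , refl) , tt) , []
accepted⇒InU (s ∷ a) with even-step (2 ∣0) s
... | refl = (((refl , refl , accepts⇒RGFrom a) , refl) , accepts⇒WeaklyInc a) , accepts⇒EvenOnce (s ∷ a)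

-- Each even letter occurs at most once (the property inherited by suffixes).
EvenAtMostOnce : Word → Set
EvenAtMostOnce w = All (λ a → 2 ∣ a → occ a w ≤ 1) w

increasing-step : ∀ {ℓ x} → ℓ ≤ x → x ≤ suc ℓ → (x ≡ ℓ → ¬ 2 ∣ ℓ) → Step ℓ x
increasing-step ℓ≤x x≤1+ℓ repeat-odd with m≤n⇒m<n∨m≡n ℓ≤x
... | inj₂ refl = repeat (repeat-odd refl)
... | inj₁ ℓ<x with ≤-antisym x≤1+ℓ ℓ<x
...   | refl = next

RG-increasing⇒accepts : ∀ {ℓ xs} → RGFrom ℓ xs → WeaklyInc (ℓ ∷ xs) → EvenAtMostOnce (ℓ ∷ xs) → Accepts ℓ xs
RG-increasing⇒accepts {xs = []} _ _ _ = [-]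
RG-increasing⇒accepts {ℓ} {x ∷ ys} ((_ , x≤1+ℓ) , rg) (ℓ≤x , wi) (ℓ-once ∷ eo) =
  increasing-step ℓ≤x x≤1+ℓ repeat-odd ∷
  RG-increasing⇒accepts (subst (λ m → RGFrom m ys) (m≤n⇒m⊔n≡n ℓ≤x) rg) wi
                        (All.map (λ {b} once 2∣b → ≤-trans (occ-mono b ℓ (x ∷ ys)) (once 2∣b)) eo)
  where
  twice : occ ℓ (ℓ ∷ ℓ ∷ ys) ≡ 2 + occ ℓ ys
  twice = trans (occ-hit ℓ (ℓ ∷ ys)) (cong suc (occ-hit ℓ ys))
  -- ℓ ∷ ℓ ∷ ys contains ℓ twice, so ℓ cannot be even.
  repeat-odd : x ≡ ℓ → ¬ 2 ∣ ℓ
  repeat-odd refl 2∣ℓ with subst (_≤ 1) twice (ℓ-once 2∣ℓ)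
  ... | s≤s ()

InU⇒accepted : ∀ {n k w} → InU n k w → Accepts 0 w
InU⇒accepted {w = []} _ = [-]
InU⇒accepted {w = x ∷ xs} ((((_ , (refl , rg)) , _) , wi) , eo) =
  next ∷ RG-increasing⇒accepts rg wi (All.map (λ once 2∣b → ≤-reflexive (once 2∣b)) eo)

accepted-maxW-range : ∀ {w} → Accepts 0 w → 1 ≤ length w → 1 ≤ maxW w × maxW w ≤ length w
accepted-maxW-range (s ∷ a) _ = ≤-trans (step-positive s) (m≤m⊔n _ _) , accepts⇒maxW (s ∷ a)

Σ-InU≡accepts : ∀ n w → 1 ≤ n → length w ≡ n → sumFrom1 n (λ k → 𝟙 (inU? n k w)) ≡ 𝟙 (accepts? 0 w)
Σ-InU≡accepts n w 1≤n ∣w∣≡n with accepts? 0 w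
... | no ¬acc = sumFrom1-zero n _ (λ k _ _ → 𝟙-no (inU? n k w) (¬acc ∘ InU⇒accepted))
... | yes acc = begin
  sumFrom1 n (λ k → 𝟙 (inU? n k w))
    ≡⟨ sumFrom1-single n (maxW w) _ 1≤max max≤n only-max ⟩
  𝟙 (inU? n (maxW w) w)
    ≡⟨ 𝟙-yes (inU? n (maxW w) w) (subst (λ m → InU m (maxW w) w) ∣w∣≡n (accepted⇒InU acc)) ⟩
  1 ∎
  where
  open ≡-Reasoning
  range : 1 ≤ maxW w × maxW w ≤ length w
  range = accepted-maxW-range acc (subst (1 ≤_) (sym ∣w∣≡n) 1≤n)
  1≤max : 1 ≤ maxW w
  1≤max = proj₁ range
  max≤n : maxW w ≤ n
  max≤n = subst (maxW w ≤_) ∣w∣≡n (proj₂ range)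
  -- The maximum of w is part of the data of membership in U(n,k).
  only-max : ∀ k → k ≢ maxW w → 𝟙 (inU? n k w) ≡ 0
  only-max k k≢max = 𝟙-no (inU? n k w) (k≢max ∘ sym ∘ proj₂ ∘ proj₁ ∘ proj₁)

accepted : ℕ → ℕ → ℕ → ℕ
accepted b len ℓ = sumOver (λ w → 𝟙 (accepts? ℓ w)) (wordsOver b len)

-- Classifying by the first letter, which must be ℓ (only if ℓ is odd) or ℓ+1.
accepted-recurrence : ∀ b len ℓ → suc ℓ ≤ b →
  accepted b (suc len) ℓ ≡ 𝟙 (step? ℓ ℓ) * accepted b len ℓ + accepted b len (suc ℓ)
accepted-recurrence b len ℓ 1+ℓ≤b = begin
  accepted b (suc len) ℓ
    ≡⟨ sumOver-wordsOver-suc _ b len ⟩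
  sumFrom1 b (λ x → sumOver (λ v → 𝟙 (accepts? ℓ (x ∷ v))) (wordsOver b len))
    ≡⟨ sumFrom1-cong b first-letter ⟩
  sumFrom1 b (λ x → 𝟙 (step? ℓ x) * A x)
    ≡⟨ sumFrom1-pair b ℓ _ 1+ℓ≤b (cong (_* A 0) (𝟙-no (step? ℓ 0) no-step-to-0)) no-other-step ⟩
  𝟙 (step? ℓ ℓ) * A ℓ + 𝟙 (step? ℓ (suc ℓ)) * A (suc ℓ)
    ≡⟨ cong (λ c → 𝟙 (step? ℓ ℓ) * A ℓ + c * A (suc ℓ)) (𝟙-yes (step? ℓ (suc ℓ)) next) ⟩
  𝟙 (step? ℓ ℓ) * A ℓ + 1 * A (suc ℓ)
    ≡⟨ cong (𝟙 (step? ℓ ℓ) * A ℓ +_) (*-identityˡ (A (suc ℓ))) ⟩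
  𝟙 (step? ℓ ℓ) * A ℓ + A (suc ℓ)
    ∎
  where
  open ≡-Reasoning
  A : ℕ → ℕ
  A = accepted b len
  first-letter : ∀ x → sumOver (λ v → 𝟙 (accepts? ℓ (x ∷ v))) (wordsOver b len) ≡ 𝟙 (step? ℓ x) * A x
  first-letter x = trans (sumOver-cong (𝟙-accepts-∷ ℓ x) (wordsOver b len))
                         (sumOver-* (𝟙 (step? ℓ x)) (λ v → 𝟙 (accepts? x v)) (wordsOver b len))
  no-step-to-0 : ¬ Step ℓ 0
  no-step-to-0 s = contradiction (step-positive s) λ ()
  no-other-step : ∀ k → k ≢ ℓ → k ≢ suc ℓ → 𝟙 (step? ℓ k) * A k ≡ 0
  no-other-step k k≢ℓ k≢1+ℓ =
    cong (_* A k) (𝟙-no (step? ℓ k) λ { (repeat _) → k≢ℓ refl ; next → k≢1+ℓ refl })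

-- Solving the recurrence: F len words from an even letter, F (len+1) from an odd one,
-- as long as the alphabet leaves room to climb len times.
accepted≡F : ∀ b len ℓ → ℓ + len ≤ b →
  (2 ∣ ℓ → accepted b len ℓ ≡ F len) × (¬ 2 ∣ ℓ → accepted b len ℓ ≡ F (suc len))
accepted≡F b zero      ℓ _     = (λ _ → refl) , (λ _ → refl)
accepted≡F b (suc len) ℓ bound = from-even , from-odd
  where
  A : ℕ → ℕ
  A = accepted b len
  room : suc ℓ + len ≤ b
  room = subst (_≤ b) (+-suc ℓ len) bound
  recurrence : accepted b (suc len) ℓ ≡ 𝟙 (step? ℓ ℓ) * A ℓ + A (suc ℓ)
  recurrence = accepted-recurrence b len ℓ (≤-trans (s≤s (m≤m+n ℓ len)) room)
  stay : (2 ∣ ℓ → A ℓ ≡ F len) × (¬ 2 ∣ ℓ → A ℓ ≡ F (suc len))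
  stay = accepted≡F b len ℓ (≤-trans (m≤n+m (ℓ + len) 1) room)
  climb : (2 ∣ suc ℓ → A (suc ℓ) ≡ F len) × (¬ 2 ∣ suc ℓ → A (suc ℓ) ≡ F (suc len))
  climb = accepted≡F b len (suc ℓ) room
  from-even : 2 ∣ ℓ → accepted b (suc len) ℓ ≡ F (suc len)
  from-even 2∣ℓ = begin
    accepted b (suc len) ℓ                ≡⟨ recurrence ⟩
    𝟙 (step? ℓ ℓ) * A ℓ + A (suc ℓ)       ≡⟨ cong (λ c → c * A ℓ + A (suc ℓ)) (𝟙-no (step? ℓ ℓ) no-repeat) ⟩
    A (suc ℓ)                             ≡⟨ proj₂ climb (even⇒next-odd 2∣ℓ) ⟩
    F (suc len)                           ∎
    where
    open ≡-Reasoning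
    no-repeat : ¬ Step ℓ ℓ
    no-repeat (repeat ¬2∣ℓ) = ¬2∣ℓ 2∣ℓ
  from-odd : ¬ 2 ∣ ℓ → accepted b (suc len) ℓ ≡ F (suc (suc len))
  from-odd ¬2∣ℓ = begin
    accepted b (suc len) ℓ                ≡⟨ recurrence ⟩
    𝟙 (step? ℓ ℓ) * A ℓ + A (suc ℓ)       ≡⟨ cong (λ c → c * A ℓ + A (suc ℓ)) (𝟙-yes (step? ℓ ℓ) (repeat ¬2∣ℓ)) ⟩
    1 * A ℓ + A (suc ℓ)                   ≡⟨ cong₂ _+_ (trans (*-identityˡ (A ℓ)) (proj₂ stay ¬2∣ℓ))
                                                       (proj₁ climb (odd⇒next-even ¬2∣ℓ)) ⟩
    F (suc len) + F len                   ∎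
    where open ≡-Reasoning

corollary4p5 : (n : ℕ) → 1 ≤ n → sumFrom1 n (cardU n) ≡ F n
corollary4p5 n 1≤n = begin
  sumFrom1 n (cardU n)
    ≡⟨ sumFrom1-cong n (λ k → length-filter≡sumOver (inU? n k) (wordsOver n n)) ⟩
  sumFrom1 n (λ k → sumOver (λ w → 𝟙 (inU? n k w)) (wordsOver n n))
    ≡⟨ sumFrom1-sumOver n (λ k w → 𝟙 (inU? n k w)) (wordsOver n n) ⟩
  sumOver (λ w → sumFrom1 n (λ k → 𝟙 (inU? n k w))) (wordsOver n n)
    ≡⟨ sumOver-wordsOver-cong n n (λ w → Σ-InU≡accepts n w 1≤n) ⟩
  accepted n n 0
    ≡⟨ proj₁ (accepted≡F n n 0 ≤-refl) (2 ∣0) ⟩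
  F n ∎
  where open ≡-Reasoning
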